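{- Let $\mathcal{S}$ be a terminating string rewrite system, i.e. a finite TRS over a finite signature in which every function symbol has arity $0$ or $1$. Define $$f(n) := \max\{\mathrm{dh}(t^\sharp,\to_{\mathrm{DP}(\mathcal{S})/\mathcal{S}}) \mid |t|\leqslant n\}.$$ Then there exists $d\in\mathbb{N}$ such that for all $n$, $$\mathrm{dc}_{\mathcal{S}}(n) \leqslant n\cdot 2^{d\cdot(f(n)+1)}.$$
   Context: $|t|$ is the number of occurrences of function symbols and variables in $t$. $\mathrm{dh}(s,\to) = \max\{n\mid \exists t,\ s\to^n t\}$ and $\mathrm{dc}_{\mathcal{S}}(n)=\max\{\mathrm{dh}(t,\to_{\mathcal{S}})\mid |t|\leqslant n\}$. Defined symbols are roots of left-hand sides. For each $f$ let $f^\sharp$ be a fresh symbol of the same arity; $t^\sharp=t$ for a variable $t$, and $t^\sharp = f^\sharp(t_1,\dots,t_n)$ for $t=f(t_1,\dots,t_n)$. $$\mathrm{DP}(\mathcal{S}) = \{l^\sharp\to u^\sharp \mid l\to r\in\mathcal{S},\ u \text{ a subterm of } r \text{ with defined root},\ u \text{ not a proper subterm of } l\}.$$ $\to_{\mathcal{P}/\mathcal{S}} = \to_{\mathcal{S}}^*\cdot\to_{\mathcal{P}}\cdot\to_{\mathcal{S}}^*$. -}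

module Defs where

open import Data.Nat using (ℕ; zero; suc; _+_; _≤_)
open import Data.Fin using (Fin)
open import Data.Sum using (_⊎_; inj₁; inj₂)
open import Data.Product using (_×_; _,_; ∃; Σ)
open import Data.Maybe using (Maybe; just; nothing)
open import Data.List using (List; map)
open import Data.List.Membership.Propositional using (_∈_)
open import Relation.Binary.PropositionalEquality using (_≡_)
open import Relation.Binary.Construct.Closure.ReflexiveTransitive using (Star)
open import Relation.Nullary using (¬_)
open import Induction.WellFounded using (WellFounded)
open import Function using (flip)

-- Terms over a signature in which every symbol has arity 0 or 1.
-- C = constants (arity 0), U = unary symbols (arity 1), variables are ℕ.

data Term (C U : Set) : Set where
  var : ℕ → Term C U
  con : C → Term C U
  app : U → Term C U → Term C U

module _ {C U : Set} where

  size : Term C U → ℕ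
  size (var x)   = 1
  size (con c)   = 1
  size (app f t) = suc (size t)

  _⟨_⟩ : Term C U → (ℕ → Term C U) → Term C U
  var x   ⟨ σ ⟩ = σ x
  con c   ⟨ σ ⟩ = con c
  app f t ⟨ σ ⟩ = app f (t ⟨ σ ⟩)

  rootSym : Term C U → Maybe (C ⊎ U)
  rootSym (var x)   = nothing
  rootSym (con c)   = just (inj₁ c)
  rootSym (app f t) = just (inj₂ f)

  data Subterm : Term C U → Term C U → Set where
    here  : ∀ {t} → Subterm t t
    there : ∀ {u t} f → Subterm u t → Subterm u (app f t)

  data ProperSubterm : Term C U → Term C U → Set where
    psub : ∀ {u t} f → Subterm u t → ProperSubterm u (app f t)

  Rules : Set₁
  Rules = Term C U → Term C U → Set

  data Step (R : Rules) : Term C U → Term C U → Set where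
    root : ∀ {l r} (σ : ℕ → Term C U) → R l r → Step R (l ⟨ σ ⟩) (r ⟨ σ ⟩)
    cong : ∀ {s t} (f : U) → Step R s t → Step R (app f s) (app f t)

  RelStep : Rules → Rules → Term C U → Term C U → Set
  RelStep P R s t = ∃ λ a → ∃ λ b →
    Star (Step R) s a × Step P a b × Star (Step R) b t

data Iter {A : Set} (_⇒_ : A → A → Set) : ℕ → A → A → Set where
  done : ∀ {a} → Iter _⇒_ zero a a
  next : ∀ {n a b c} → a ⇒ b → Iter _⇒_ n b c → Iter _⇒_ (suc n) a c

-- IsDh _⇒_ s m  :  m = dh(s, ⇒) = max { n | ∃ t, s ⇒^n t }
IsDh : {A : Set} → (A → A → Set) → A → ℕ → Set
IsDh _⇒_ s m = (∃ λ t → Iter _⇒_ m s t) × (∀ k t → Iter _⇒_ k s t → k ≤ m)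

STerm : ℕ → ℕ → Set
STerm c u = Term (Fin c) (Fin u)

TRS : ℕ → ℕ → Set
TRS c u = List (STerm c u × STerm c u)

module _ {c u : ℕ} where

  ruleOf : TRS c u → Rules
  ruleOf S l r = (l , r) ∈ S

  Terminating : TRS c u → Set
  Terminating S = WellFounded (flip (Step (ruleOf S)))

  Defined : TRS c u → Fin c ⊎ Fin u → Set
  Defined S s = ∃ λ l → ∃ λ r → (l , r) ∈ S × rootSym l ≡ just s

  -- Marked signature: inj₁ = original symbols, inj₂ = marked copies f♯
  MTerm : Set
  MTerm = Term (Fin c ⊎ Fin c) (Fin u ⊎ Fin u)

  emb : STerm c u → MTerm
  emb (var x)   = var x
  emb (con a)   = con (inj₁ a)
  emb (app f t) = app (inj₁ f) (emb t)

  sharp : STerm c u → MTerm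
  sharp (var x)   = var x
  sharp (con a)   = con (inj₂ a)
  sharp (app f t) = app (inj₂ f) (emb t)

  liftRules : TRS c u → Rules
  liftRules S l' r' = ∃ λ l → ∃ λ r → (l , r) ∈ S × l' ≡ emb l × r' ≡ emb r

  DP : TRS c u → Rules
  DP S l' r' = ∃ λ l → ∃ λ r → ∃ λ v →
    (l , r) ∈ S × Subterm v r × (∃ λ s → rootSym v ≡ just s × Defined S s) ×
    ¬ ProperSubterm v l × l' ≡ sharp l × r' ≡ sharp v

  -- IsF S n F  :  F = f(n) = max { dh(t♯, →_{DP(S)/S}) | |t| ≤ n }
  IsF : TRS c u → ℕ → ℕ → Set
  IsF S n F =
    (∃ λ t → size t ≤ n × IsDh (RelStep (DP S) (liftRules S)) (sharp t) F) ×
    (∀ t m → size t ≤ n → IsDh (RelStep (DP S) (liftRules S)) (sharp t) m → m ≤ F)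

  -- IsDc S n D  :  D = dc_S(n) = max { dh(t, →_S) | |t| ≤ n }
  IsDc : TRS c u → ℕ → ℕ → Set
  IsDc S n D =
    (∃ λ t → size t ≤ n × IsDh (Step (ruleOf S)) t D) ×
    (∀ t m → size t ≤ n → IsDh (Step (ruleOf S)) t m → m ≤ D)

-- Proof by a potential.  Give every symbol of t the budget F = f(n) and weigh a
-- defined symbol of budget b by K^b, K = 2^d > |r| for each rule l → r.  The
-- invariant is that the subterm at a defined symbol of budget b has DP-height ≤ b.
-- A root step  lσ → rσ  consumes a defined symbol of weight K^b and creates the
-- at most |r| new symbols of r; each new defined symbol v gives a dependency pair
-- l♯ → v♯, so budget b ∸ 1 keeps the invariant and the new weight is < K^b.
-- Hence every step decreases the potential, and dh(t) ≤ |t|·K^F.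

module Submission where

open import Defs
open import Data.Nat using (ℕ; zero; suc; _+_; _*_; _^_; _≤_; _<_; z≤n; s≤s; _∸_; _⊔_; _≤?_; NonZero)
open import Data.Nat.Properties
open import Data.Fin using (Fin) renaming (_≟_ to _≟Fin_)
open import Data.Sum using (_⊎_; inj₁; inj₂)
import Data.Sum.Properties as Sum
open import Data.Product using (∃; _×_; _,_; proj₁; proj₂)
open import Data.Maybe using (Maybe; just)
import Data.Maybe.Properties as Maybe
open import Data.List using (List; []; _∷_; _++_; map)
open import Data.List.Membership.Propositional using (_∈_; find; lose)
open import Data.List.Membership.Propositional.Properties using (∈-++⁺ˡ; ∈-++⁺ʳ; ∈-map⁺)
open import Data.List.Relation.Unary.Any using (Any; any?; here; there)
open import Data.List.Relation.Unary.All as All using (All; []; _∷_)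
import Data.List.Relation.Unary.All.Properties as All
open import Relation.Binary.PropositionalEquality
  using (_≡_; _≢_; refl; sym; trans; subst; subst₂; module ≡-Reasoning) renaming (cong to ≡-cong)
open import Relation.Binary.Definitions using (DecidableEquality)
open import Relation.Binary.Construct.Closure.ReflexiveTransitive using (Star; ε; _◅_)
open import Relation.Nullary using (¬_; Dec; yes; no)
open import Relation.Nullary.Decidable using (map′; decidable-stable; ¬¬-excluded-middle)
open import Relation.Nullary.Negation using (DoubleNegation; ¬¬-Monad)
open import Data.Empty using (⊥; ⊥-elim)
open import Data.Unit using (⊤; tt)
open import Effect.Monad using (RawMonad)
open import Induction.WellFounded using (Acc; acc)
open import Function using (flip; _∘_; id)
open import Level using (0ℓ)

open RawMonad (¬¬-Monad {0ℓ}) using (return; _>>=_)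

iter-++ : ∀ {A : Set} {_⇒_ : A → A → Set} {j k a b c} →
          Iter _⇒_ j a b → Iter _⇒_ k b c → Iter _⇒_ (j + k) a c
iter-++ done       q = q
iter-++ (next x p) q = next x (iter-++ p q)

module TermFacts {C U : Set} where

  Tm : Set
  Tm = Term C U

  -- Over a unary signature a context is a string of unary symbols.
  plug : List U → Tm → Tm
  plug []      t = t
  plug (f ∷ E) t = app f (plug E t)

  plug-++ : ∀ E E' t → plug E (plug E' t) ≡ plug (E ++ E') t
  plug-++ []      E' t = refl
  plug-++ (f ∷ E) E' t = ≡-cong (app f) (plug-++ E E' t)

  plug-subst : ∀ E t σ → (plug E t) ⟨ σ ⟩ ≡ plug E (t ⟨ σ ⟩)
  plug-subst []      t σ = refl
  plug-subst (f ∷ E) t σ = ≡-cong (app f) (plug-subst E t σ)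

  step-plug : ∀ {R s t} E → Step R s t → Step R (plug E s) (plug E t)
  step-plug []      st = st
  step-plug (f ∷ E) st = cong f (step-plug E st)

  iter-plug : ∀ {R k s t} E → Iter (Step R) k s t → Iter (Step R) k (plug E s) (plug E t)
  iter-plug E done         = done
  iter-plug E (next st it) = next (step-plug E st) (iter-plug E it)

  subterm⇒plug : ∀ {v t : Tm} → Subterm v t → ∃ λ E → t ≡ plug E v
  subterm⇒plug here = [] , refl
  subterm⇒plug (there f p) with subterm⇒plug p
  ... | E , eq = f ∷ E , ≡-cong (app f) eq

  subterm-trans : ∀ {a b c : Tm} → Subterm a b → Subterm b c → Subterm a c
  subterm-trans p here        = p
  subterm-trans p (there f q) = there f (subterm-trans p q)

  proper⇒subterm : ∀ {v t : Tm} → ProperSubterm v t → Subterm v t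
  proper⇒subterm (psub f p) = there f p

  size-subterm : ∀ {v t : Tm} → Subterm v t → size v ≤ size t
  size-subterm here        = ≤-refl
  size-subterm (there f p) = m≤n⇒m≤1+n (size-subterm p)

  var-subterm⇒proper : ∀ {y} {t : Tm} → (∀ x → t ≢ var x) → Subterm (var y) t → ProperSubterm (var y) t
  var-subterm⇒proper {t = var x} t≢var here = ⊥-elim (t≢var x refl)
  var-subterm⇒proper _ (there f p) = psub f p

  app-injectiveˡ : ∀ {f g : U} {s t : Tm} → app f s ≡ app g t → f ≡ g
  app-injectiveˡ refl = refl

  app-injectiveʳ : ∀ {f g : U} {s t : Tm} → app f s ≡ app g t → s ≡ t
  app-injectiveʳ refl = refl

  subst-ext : ∀ (t : Tm) {σ τ} → (∀ y → Subterm (var y) t → σ y ≡ τ y) → t ⟨ σ ⟩ ≡ t ⟨ τ ⟩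
  subst-ext (var x)   h = h x here
  subst-ext (con a)   h = refl
  subst-ext (app f t) h = ≡-cong (app f) (subst-ext t (λ y p → h y (there f p)))

  subst-agree : ∀ (t : Tm) {σ τ y} → t ⟨ σ ⟩ ≡ t ⟨ τ ⟩ → Subterm (var y) t → σ y ≡ τ y
  subst-agree (var x)   eq here         = eq
  subst-agree (app f t) eq (there .f p) = subst-agree t (app-injectiveʳ eq) p

  subst-id : ∀ (t : Tm) → t ⟨ var ⟩ ≡ t
  subst-id (var x)   = refl
  subst-id (con a)   = refl
  subst-id (app f t) = ≡-cong (app f) (subst-id t)

  data StepView (R : Rules {C} {U}) (s t : Tm) : Set where
    at-root  : ∀ l r σ → R l r → s ≡ l ⟨ σ ⟩ → t ≡ r ⟨ σ ⟩ → StepView R s t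
    below    : ∀ f s₀ t₀ → s ≡ app f s₀ → t ≡ app f t₀ → Step R s₀ t₀ → StepView R s t

  step-view : ∀ {R s t} → Step R s t → StepView R s t
  step-view (root σ x)  = at-root _ _ σ x refl refl
  step-view (cong f st) = below f _ _ refl refl st

  module Decidable (_≟C_ : DecidableEquality C) (_≟U_ : DecidableEquality U) where

    _≟T_ : DecidableEquality Tm
    var x   ≟T var y   = map′ (≡-cong var) (λ { refl → refl }) (x ≟ y)
    con a   ≟T con b   = map′ (≡-cong con) (λ { refl → refl }) (a ≟C b)
    app f s ≟T app g t with f ≟U g | s ≟T t
    ... | yes refl | yes refl = yes refl
    ... | no f≢g   | _        = no (f≢g ∘ app-injectiveˡ)
    ... | yes _    | no s≢t   = no (s≢t ∘ app-injectiveʳ)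
    var _   ≟T con _   = no λ ()
    var _   ≟T app _ _ = no λ ()
    con _   ≟T var _   = no λ ()
    con _   ≟T app _ _ = no λ ()
    app _ _ ≟T var _   = no λ ()
    app _ _ ≟T con _   = no λ ()

    subterm? : ∀ (v w : Tm) → Dec (Subterm v w)
    subterm? v w with v ≟T w
    subterm? v w         | yes refl = yes here
    subterm? v (var x)   | no v≢w   = no λ { here → v≢w refl }
    subterm? v (con a)   | no v≢w   = no λ { here → v≢w refl }
    subterm? v (app f w) | no v≢w with subterm? v w
    ... | yes p = yes (there f p)
    ... | no ¬p = no λ { here → v≢w refl ; (there _ p) → ¬p p }

    proper? : ∀ (v w : Tm) → Dec (ProperSubterm v w)
    proper? v (var x)   = no λ ()
    proper? v (con a)   = no λ ()
    proper? v (app f w) = map′ (psub f) (λ { (psub _ p) → p }) (subterm? v w)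

open TermFacts

-- The sum of the sizes of all right-hand sides: the constant d of the theorem.
rhsTotalSize : ∀ {c u} → TRS c u → ℕ
rhsTotalSize []            = 0
rhsTotalSize ((l , r) ∷ S) = size r + rhsTotalSize S

rhs-size≤total : ∀ {c u} (S : TRS c u) {l r} → (l , r) ∈ S → size r ≤ rhsTotalSize S
rhs-size≤total ((l , r) ∷ S) (here refl) = m≤m+n (size r) (rhsTotalSize S)
rhs-size≤total ((l' , r') ∷ S) (there m) =
  ≤-trans (rhs-size≤total S m) (m≤n+m (rhsTotalSize S) (size r'))

module Analysis {c u : ℕ} (S : TRS c u) (wf : Terminating S) where

  T : Set
  T = STerm c u

  M : Set
  M = MTerm {c} {u}

  infix 4 _→S_
  _→S_ : T → T → Set
  _→S_ = Step (ruleOf S)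

  _→DP/S_ : M → M → Set
  _→DP/S_ = RelStep (DP S) (liftRules S)

  open Decidable {Fin c} {Fin u} _≟Fin_ _≟Fin_

  HasRoot : T → Set
  HasRoot t = ∃ λ h → rootSym t ≡ just h

  no-endless-predicate : (P : T → Set) → (∀ s → P s → ∃ λ t → s →S t × P t) → ∀ s → ¬ P s
  no-endless-predicate P step s = go s (wf s)
    where
    go : ∀ s → Acc (flip _→S_) s → ¬ P s
    go s (acc rs) p with step s p
    ... | t , s→t , pt = go t (rs s→t) pt

  -- A rule  x → r  would rewrite every term forever.
  lhs-not-var : ∀ {l r} → (l , r) ∈ S → ∀ x → l ≢ var x
  lhs-not-var {r = r} l→r x refl =
    no-endless-predicate (λ _ → ⊤) (λ s _ → r ⟨ (λ _ → s) ⟩ , root (λ _ → s) l→r , tt) (var 0) tt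

  lhs-root : ∀ {l r} → (l , r) ∈ S → HasRoot l
  lhs-root {var x}   l→r = ⊥-elim (lhs-not-var l→r x refl)
  lhs-root {con a}   l→r = inj₁ a , refl
  lhs-root {app f l} l→r = inj₂ f , refl

  -- Variable condition: if y occurs in r but not in l, instantiating y by l
  -- gives  l →S E[l]  and hence an infinite derivation  l →S E[l] →S E[E[l]] ⋯.
  rhs-var-in-lhs : ∀ {l r y} → (l , r) ∈ S → Subterm (var y) r → ¬ ¬ Subterm (var y) l
  rhs-var-in-lhs {l} {r} {y} l→r y∈r y∉l =
    no-endless-predicate InContext grow l ([] , refl)
    where
    E : List (Fin u)
    E = proj₁ (subterm⇒plug y∈r)

    σ : ℕ → T
    σ z with z ≟ y
    ... | yes _ = l
    ... | no _  = var z

    σ-fixes-l : l ⟨ σ ⟩ ≡ l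
    σ-fixes-l = trans (subst-ext l fixes) (subst-id l)
      where
      fixes : ∀ z → Subterm (var z) l → σ z ≡ var z
      fixes z z∈l with z ≟ y
      ... | yes refl = ⊥-elim (y∉l z∈l)
      ... | no _     = refl

    σy : σ y ≡ l
    σy with y ≟ y
    ... | yes _ = refl
    ... | no y≢y = ⊥-elim (y≢y refl)

    r-pumps : r ⟨ σ ⟩ ≡ plug E l
    r-pumps = begin
      r ⟨ σ ⟩              ≡⟨ ≡-cong (_⟨ σ ⟩) (proj₂ (subterm⇒plug y∈r)) ⟩
      (plug E (var y)) ⟨ σ ⟩ ≡⟨ plug-subst E (var y) σ ⟩
      plug E (σ y)         ≡⟨ ≡-cong (plug E) σy ⟩
      plug E l             ∎
      where open ≡-Reasoning

    InContext : T → Set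
    InContext s = ∃ λ E' → s ≡ plug E' l

    grow : ∀ s → InContext s → ∃ λ t → s →S t × InContext t
    grow s (E' , refl) = plug E' (plug E l) ,
      step-plug E' (subst₂ _→S_ σ-fixes-l r-pumps (root σ l→r)) , E' ++ E , plug-++ E' E l

  rhs-var-below-lhs : ∀ {l r y} → (l , r) ∈ S → Subterm (var y) r → ProperSubterm (var y) l
  rhs-var-below-lhs {l} {y = y} l→r y∈r =
    var-subterm⇒proper (lhs-not-var l→r) (decidable-stable (subterm? (var y) l) (rhs-var-in-lhs l→r y∈r))

  contractum-unique : ∀ {l r σ τ} → (l , r) ∈ S → l ⟨ σ ⟩ ≡ l ⟨ τ ⟩ → r ⟨ σ ⟩ ≡ r ⟨ τ ⟩
  contractum-unique {l} {r} l→r eq =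
    subst-ext r (λ y y∈r → subst-agree l eq (proper⇒subterm (rhs-var-below-lhs l→r y∈r)))

  unmark : M → T
  unmark (var x)         = var x
  unmark (con (inj₁ a))  = con a
  unmark (con (inj₂ a))  = con a
  unmark (app (inj₁ f) t) = app f (unmark t)
  unmark (app (inj₂ f) t) = app f (unmark t)

  unmark-emb : ∀ (t : T) → unmark (emb t) ≡ t
  unmark-emb (var x)   = refl
  unmark-emb (con a)   = refl
  unmark-emb (app f t) = ≡-cong (app f) (unmark-emb t)

  unmark-sharp : ∀ (t : T) → unmark (sharp t) ≡ t
  unmark-sharp (var x)   = refl
  unmark-sharp (con a)   = refl
  unmark-sharp (app f t) = ≡-cong (app f) (unmark-emb t)

  unmark-subst : ∀ (t : M) σ → unmark (t ⟨ σ ⟩) ≡ (unmark t) ⟨ unmark ∘ σ ⟩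
  unmark-subst (var x)          σ = refl
  unmark-subst (con (inj₁ a))   σ = refl
  unmark-subst (con (inj₂ a))   σ = refl
  unmark-subst (app (inj₁ f) t) σ = ≡-cong (app f) (unmark-subst t σ)
  unmark-subst (app (inj₂ f) t) σ = ≡-cong (app f) (unmark-subst t σ)

  emb-subst : ∀ (t : T) σ → emb (t ⟨ σ ⟩) ≡ (emb t) ⟨ emb ∘ σ ⟩
  emb-subst (var x)   σ = refl
  emb-subst (con a)   σ = refl
  emb-subst (app f t) σ = ≡-cong (app (inj₁ f)) (emb-subst t σ)

  sharp-subst : ∀ (t : T) σ → HasRoot t → sharp (t ⟨ σ ⟩) ≡ (sharp t) ⟨ emb ∘ σ ⟩
  sharp-subst (con a)   σ _ = refl
  sharp-subst (app f t) σ _ = ≡-cong (app (inj₂ f)) (emb-subst t σ)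

  var-in-emb : ∀ {y} (t : T) → Subterm (var y) (emb t) → Subterm (var y) t
  var-in-emb (var x)   here        = here
  var-in-emb (app f t) (there _ p) = there f (var-in-emb t p)

  var-in-sharp : ∀ {y} (t : T) → Subterm (var y) (sharp t) → Subterm (var y) t
  var-in-sharp (var x)   here        = here
  var-in-sharp (app f t) (there _ p) = there f (var-in-emb t p)

  IsUnmarked : M → Set
  IsUnmarked m = ∃ λ s → m ≡ emb s

  emb-match-unmarked : ∀ (l : T) {σ : ℕ → M} {s : T} {y} →
    (emb l) ⟨ σ ⟩ ≡ emb s → Subterm (var y) l → IsUnmarked (σ y)
  emb-match-unmarked (var x)   {s = s}        eq here        = s , eq
  emb-match-unmarked (app f l) {s = app g s₀} eq (there _ p) = emb-match-unmarked l (app-injectiveʳ eq) p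

  sharp-match-unmarked : ∀ (l : T) {σ : ℕ → M} {s : T} {y} →
    (sharp l) ⟨ σ ⟩ ≡ sharp s → ProperSubterm (var y) l → IsUnmarked (σ y)
  sharp-match-unmarked (app f l) {s = app g s₀} eq (psub _ p) = emb-match-unmarked l (app-injectiveʳ eq) p

  emb-unmark : ∀ {m : M} → IsUnmarked m → emb (unmark m) ≡ m
  emb-unmark (s , refl) = ≡-cong emb (unmark-emb s)

  emb≢sharp : ∀ (l s : T) {σ} → HasRoot l → (emb l) ⟨ σ ⟩ ≢ sharp s
  emb≢sharp (con a)   (var _)   _ ()
  emb≢sharp (con a)   (con _)   _ ()
  emb≢sharp (con a)   (app _ _) _ ()
  emb≢sharp (app f l) (var _)   _ ()
  emb≢sharp (app f l) (con _)   _ ()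
  emb≢sharp (app f l) (app _ _) _ ()

  sharp≢emb : ∀ (l s : T) {σ} → HasRoot l → (sharp l) ⟨ σ ⟩ ≢ emb s
  sharp≢emb (con a)   (var _)   _ ()
  sharp≢emb (con a)   (con _)   _ ()
  sharp≢emb (con a)   (app _ _) _ ()
  sharp≢emb (app f l) (var _)   _ ()
  sharp≢emb (app f l) (con _)   _ ()
  sharp≢emb (app f l) (app _ _) _ ()

  emb-step : ∀ {s t} → s →S t → Step (liftRules S) (emb s) (emb t)
  emb-step (root {l} {r} σ l→r) =
    subst₂ (Step (liftRules S)) (sym (emb-subst l σ)) (sym (emb-subst r σ))
           (root (emb ∘ σ) (l , r , l→r , refl , refl))
  emb-step (cong f st) = cong (inj₁ f) (emb-step st)

  emb-step⁻¹ : ∀ {a b} (s : T) → a ≡ emb s → Step (liftRules S) a b → ∃ λ s' → b ≡ emb s' × s →S s'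
  emb-step⁻¹ s eq (root σ (l , r , l→r , refl , refl)) =
    r ⟨ unmark ∘ σ ⟩ , contractum , subst (_→S r ⟨ unmark ∘ σ ⟩) (sym redex) (root (unmark ∘ σ) l→r)
    where
    redex : s ≡ l ⟨ unmark ∘ σ ⟩
    redex = begin
      s                            ≡⟨ sym (unmark-emb s) ⟩
      unmark (emb s)               ≡⟨ ≡-cong unmark (sym eq) ⟩
      unmark ((emb l) ⟨ σ ⟩)       ≡⟨ unmark-subst (emb l) σ ⟩
      (unmark (emb l)) ⟨ unmark ∘ σ ⟩ ≡⟨ ≡-cong (_⟨ unmark ∘ σ ⟩) (unmark-emb l) ⟩
      l ⟨ unmark ∘ σ ⟩             ∎
      where open ≡-Reasoning
    contractum : (emb r) ⟨ σ ⟩ ≡ emb (r ⟨ unmark ∘ σ ⟩)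
    contractum = trans
      (subst-ext (emb r) (λ y y∈r → sym (emb-unmark
        (emb-match-unmarked l eq (proper⇒subterm (rhs-var-below-lhs l→r (var-in-emb r y∈r)))))))
      (sym (emb-subst r (unmark ∘ σ)))
  emb-step⁻¹ (app g s₀) refl (cong _ st) with emb-step⁻¹ s₀ refl st
  ... | s₀' , refl , st' = app g s₀' , refl , cong g st'

  sharp-step⁻¹ : ∀ {a b} (s : T) → a ≡ sharp s → Step (liftRules S) a b → ∃ λ s' → b ≡ sharp s' × s →S s'
  sharp-step⁻¹ s eq (root σ (l , r , l→r , refl , refl)) = ⊥-elim (emb≢sharp l s (lhs-root l→r) eq)
  sharp-step⁻¹ (app g s₀) refl (cong _ st) with emb-step⁻¹ s₀ refl st
  ... | s₀' , refl , st' = app g s₀' , refl , cong g st'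

  sharp-star⁻¹ : ∀ {a b} (s : T) → a ≡ sharp s → Star (Step (liftRules S)) a b →
                 ∃ λ s' → b ≡ sharp s' × ∃ λ j → Iter _→S_ j s s'
  sharp-star⁻¹ s eq ε = s , eq , 0 , done
  sharp-star⁻¹ s eq (st ◅ sts) with sharp-step⁻¹ s eq st
  ... | s₁ , eq₁ , st' with sharp-star⁻¹ s₁ eq₁ sts
  ... | s' , eq' , j , it = s' , eq' , suc j , next st' it

  dp-not-unmarked : ∀ {a b} (s : T) → a ≡ emb s → ¬ Step (DP S) a b
  dp-not-unmarked s eq (root σ (l , r , v , l→r , _ , _ , _ , refl , refl)) = sharp≢emb l s (lhs-root l→r) eq
  dp-not-unmarked (app g s₀) refl (cong _ st) = dp-not-unmarked s₀ refl st

  dp-step⁻¹ : ∀ {a b} (s : T) → a ≡ sharp s → Step (DP S) a b →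
              ∃ λ s' → b ≡ sharp s' × ∃ λ E → s →S plug E s'
  dp-step⁻¹ s eq (root σ (l , r , v , l→r , v⊴r , (h , v-root , _) , _ , refl , refl))
    with subterm⇒plug v⊴r
  ... | E , r≡E[v] = v ⟨ unmark ∘ σ ⟩ , contractum , E ,
                     subst₂ _→S_ (sym redex) reduct (root (unmark ∘ σ) l→r)
    where
    redex : s ≡ l ⟨ unmark ∘ σ ⟩
    redex = begin
      s                                ≡⟨ sym (unmark-sharp s) ⟩
      unmark (sharp s)                 ≡⟨ ≡-cong unmark (sym eq) ⟩
      unmark ((sharp l) ⟨ σ ⟩)         ≡⟨ unmark-subst (sharp l) σ ⟩
      (unmark (sharp l)) ⟨ unmark ∘ σ ⟩ ≡⟨ ≡-cong (_⟨ unmark ∘ σ ⟩) (unmark-sharp l) ⟩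
      l ⟨ unmark ∘ σ ⟩                 ∎
      where open ≡-Reasoning
    reduct : r ⟨ unmark ∘ σ ⟩ ≡ plug E (v ⟨ unmark ∘ σ ⟩)
    reduct = trans (≡-cong (_⟨ unmark ∘ σ ⟩) r≡E[v]) (plug-subst E v (unmark ∘ σ))
    contractum : (sharp v) ⟨ σ ⟩ ≡ sharp (v ⟨ unmark ∘ σ ⟩)
    contractum = trans
      (subst-ext (sharp v) (λ y y∈v → sym (emb-unmark (sharp-match-unmarked l eq
        (rhs-var-below-lhs l→r (subterm-trans (var-in-sharp v y∈v) v⊴r))))))
      (sym (sharp-subst v (unmark ∘ σ) (h , v-root)))
  dp-step⁻¹ (app g s₀) refl (cong _ st) = ⊥-elim (dp-not-unmarked s₀ refl st)

  chain⇒derivation : ∀ k {a} (t : T) → Iter _→DP/S_ k (sharp t) a →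
                     ∃ λ j → k ≤ j × ∃ λ t' → Iter _→S_ j t t'
  chain⇒derivation zero t done = 0 , z≤n , t , done
  chain⇒derivation (suc k) t (next (_ , _ , pre , dp , post) chain)
    with sharp-star⁻¹ t refl pre
  ... | s₁ , eq₁ , j₁ , d₁ with dp-step⁻¹ s₁ eq₁ dp
  ... | s₂ , eq₂ , E , st with sharp-star⁻¹ s₂ eq₂ post
  ... | s₃ , refl , j₂ , d₂ with chain⇒derivation k s₃ chain
  ... | j₃ , k≤j₃ , t' , d₃ =
    j₁ + suc (j₂ + j₃) ,
    ≤-trans (s≤s (≤-trans k≤j₃ (m≤n+m j₃ j₂))) (m≤n+m (suc (j₂ + j₃)) j₁) ,
    plug E t' , iter-++ d₁ (next st (iter-++ (iter-plug E d₂) (iter-plug E d₃)))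

  -- Classically, S is finitely branching: the rules form a finite list and a
  -- redex determines its contractum.  Successors collected at the root from the
  -- rules  Rs ⊆ S:
  RootCovered : TRS c u → T → List T → Set
  RootCovered Rs s L = ∀ l r σ → (l , r) ∈ Rs → s ≡ l ⟨ σ ⟩ → r ⟨ σ ⟩ ∈ L

  root-successors : ∀ (Rs : TRS c u) → (∀ {ρ} → ρ ∈ Rs → ρ ∈ S) → ∀ s →
                    DoubleNegation (∃ λ L → RootCovered Rs s L × All (s →S_) L)
  root-successors [] _ s = return ([] , (λ _ _ _ ()) , [])
  root-successors ((l , r) ∷ Rs) Rs⊆S s = do
    (L , covered , steps) ← root-successors Rs (Rs⊆S ∘ there) s
    ¬¬-excluded-middle {A = ∃ λ σ → s ≡ l ⟨ σ ⟩} >>= λ where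
      (yes (σ , s≡lσ)) → return (r ⟨ σ ⟩ ∷ L , covered-match σ s≡lσ covered ,
                                 subst (_→S r ⟨ σ ⟩) (sym s≡lσ) (root σ (Rs⊆S (here refl))) ∷ steps)
      (no no-match)    → return (L , covered-no-match no-match covered , steps)
    where
    covered-match : ∀ σ₀ → s ≡ l ⟨ σ₀ ⟩ → ∀ {L} → RootCovered Rs s L →
                    RootCovered ((l , r) ∷ Rs) s (r ⟨ σ₀ ⟩ ∷ L)
    covered-match σ₀ s≡lσ₀ covered _ _ _ (here refl) s≡lσ =
      here (contractum-unique (Rs⊆S (here refl)) (trans (sym s≡lσ) s≡lσ₀))
    covered-match σ₀ s≡lσ₀ covered l′ r′ σ (there ρ∈Rs) s≡lσ = there (covered l′ r′ σ ρ∈Rs s≡lσ)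
    covered-no-match : ¬ (∃ λ σ → s ≡ l ⟨ σ ⟩) → ∀ {L} → RootCovered Rs s L →
                       RootCovered ((l , r) ∷ Rs) s L
    covered-no-match no-match covered _ _ _ (here refl) s≡lσ = ⊥-elim (no-match (_ , s≡lσ))
    covered-no-match no-match covered l′ r′ σ (there ρ∈Rs) s≡lσ = covered l′ r′ σ ρ∈Rs s≡lσ

  InnerCovered : T → List T → Set
  InnerCovered s L = ∀ f s₀ t₀ → s ≡ app f s₀ → s₀ →S t₀ → app f t₀ ∈ L

  Successors : T → List T → Set
  Successors s L = (∀ t → s →S t → t ∈ L) × All (s →S_) L

  all-successors : ∀ {s L L'} → RootCovered S s L → InnerCovered s L' → ∀ t → s →S t → t ∈ L ++ L'
  all-successors covered inner t st with step-view st
  ... | at-root l r σ l→r s≡lσ refl    = ∈-++⁺ˡ (covered l r σ l→r s≡lσ)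
  ... | below f s₀ t₀ s≡fs₀ refl s₀→t₀ = ∈-++⁺ʳ _ (inner f s₀ t₀ s≡fs₀ s₀→t₀)

  successors : ∀ s → DoubleNegation (∃ (Successors s))
  inner-successors : ∀ s → DoubleNegation (∃ λ L → InnerCovered s L × All (s →S_) L)

  successors s = do
    (L , covered , steps) ← root-successors S id s
    (L' , inner , steps') ← inner-successors s
    return (L ++ L' , all-successors covered inner , All.++⁺ steps steps')

  inner-successors (var x)    = return ([] , (λ _ _ _ ()) , [])
  inner-successors (con a)    = return ([] , (λ _ _ _ ()) , [])
  inner-successors (app f s₀) = do
    (L , covered , steps) ← successors s₀
    return (map (app f) L , (λ { _ _ t₀ refl s₀→t₀ → ∈-map⁺ (app f) (covered t₀ s₀→t₀) }) ,
            All.map⁺ (All.map (cong f) steps))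

  -- König's lemma: a terminating, finitely branching term has bounded
  -- derivation lengths (classically).
  HeightBound : T → ℕ → Set
  HeightBound s B = ∀ k t → Iter _→S_ k s t → k ≤ B

  common-bound : ∀ L → All (λ t → ∃ (HeightBound t)) L → ∃ λ B → ∀ {t} → t ∈ L → HeightBound t B
  common-bound [] [] = 0 , λ ()
  common-bound (t ∷ L) ((B₁ , bound₁) ∷ bounds) with common-bound L bounds
  ... | B₂ , bound₂ = B₁ ⊔ B₂ , λ
    { (here refl) k t' d → ≤-trans (bound₁ k t' d) (m≤m⊔n B₁ B₂)
    ; (there t∈L) k t' d → ≤-trans (bound₂ t∈L k t' d) (m≤n⊔m B₁ B₂) }

  height-bounded : ∀ s → DoubleNegation (∃ (HeightBound s))
  height-bounded s = go s (wf s)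
    where
    one-more : ∀ {s L} → (∀ t → s →S t → t ∈ L) →
               (∃ λ B → ∀ {t} → t ∈ L → HeightBound t B) → ∃ (HeightBound s)
    one-more covered (B , bound) = suc B , λ
      { zero t d → z≤n
      ; (suc k) t (next st d) → s≤s (bound (covered _ st) k t d) }
    go : ∀ s → Acc (flip _→S_) s → DoubleNegation (∃ (HeightBound s))
    go s (acc rs) = do
      (L , covered , steps) ← successors s
      bounds ← All.mapM 0ℓ ¬¬-Monad (λ st → go _ (rs st)) steps
      return (one-more covered (common-bound L bounds))

  bounded-has-max : ∀ (P : ℕ → Set) B → P 0 → (∀ k → P k → k ≤ B) →
                    DoubleNegation (∃ λ m → P m × (∀ k → P k → k ≤ m))
  bounded-has-max P zero    p₀ bounded = return (0 , p₀ , bounded)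
  bounded-has-max P (suc B) p₀ bounded = ¬¬-excluded-middle {A = P (suc B)} >>= λ where
    (yes p) → return (suc B , p , bounded)
    (no ¬p) → bounded-has-max P B p₀ (λ k pk → ≤-pred (≤∧≢⇒< (bounded k pk) λ { refl → ¬p pk }))

  DPHeight≤ : T → ℕ → Set
  DPHeight≤ t b = ∀ k a → Iter _→DP/S_ k (sharp t) a → k ≤ b

  -- For |t| ≤ n, the derivation height of t♯ exists (it is bounded by that of t,
  -- which exists by König's lemma) and is at most  f(n) = F.  The conclusion is
  -- decidable, so the classical reasoning is harmless.
  dp-height≤f : ∀ n F t → size t ≤ n → IsF S n F → DPHeight≤ t F
  dp-height≤f n F t |t|≤n isF k a chain = decidable-stable (k ≤? F) do
    (B , bounded) ← height-bounded t
    (m , chain-m , maximal) ← bounded-has-max Chain B (sharp t , done) (chain≤ B bounded)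
    return (≤-trans (maximal k (a , chain))
                    (proj₂ isF t m |t|≤n (chain-m , λ j a' ch → maximal j (a' , ch))))
    where
    Chain : ℕ → Set
    Chain j = ∃ λ a → Iter _→DP/S_ j (sharp t) a
    chain≤ : ∀ B → HeightBound t B → ∀ j → Chain j → j ≤ B
    chain≤ B bounded j (a , ch) with chain⇒derivation j t ch
    ... | j' , j≤j' , t' , d = ≤-trans j≤j' (bounded j' t' d)

  -- Budgets are attached to the symbols of a term; a defined
  -- symbol with budget b weighs  K^b,  where  K = 2^d  exceeds every rhs size,
  -- and an undefined symbol weighs nothing.
  defined? : ∀ h → Dec (Defined S h)
  defined? h = map′ found listed (any? (λ ρ → ≟-symbol (rootSym (proj₁ ρ)) (just h)) S)
    where
    ≟-symbol : DecidableEquality (Maybe (Fin c ⊎ Fin u))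
    ≟-symbol = Maybe.≡-dec (Sum.≡-dec _≟Fin_ _≟Fin_)
    RootedAt : STerm c u × STerm c u → Set
    RootedAt ρ = rootSym (proj₁ ρ) ≡ just h
    found : Any RootedAt S → Defined S h
    found any with find any
    ... | (l , r) , l→r , l-root = l , r , l→r , l-root
    listed : Defined S h → Any RootedAt S
    listed (l , r , l→r , l-root) = lose l→r l-root

  K : ℕ
  K = 2 ^ rhsTotalSize S

  K≢0 : NonZero K
  K≢0 = m^n≢0 2 (rhsTotalSize S)

  weight : Fin c ⊎ Fin u → ℕ → ℕ
  weight h b with defined? h
  ... | yes _ = K ^ b
  ... | no _  = 0

  weight-defined : ∀ h b → Defined S h → weight h b ≡ K ^ b
  weight-defined h b def with defined? h
  ... | yes _  = refl
  ... | no ¬def = ⊥-elim (¬def def)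

  weight≤ : ∀ h b → weight h b ≤ K ^ b
  weight≤ h b with defined? h
  ... | yes _ = ≤-refl
  ... | no _  = z≤n

  -- Symbols created by a rule applied at budget b receive budget  b ∸ 1;
  -- their weight is at most  N b,  and a whole rhs weighs less than  K^b.
  N : ℕ → ℕ
  N zero    = 0
  N (suc b) = K ^ b

  fresh-weight≤ : ∀ h b → (Defined S h → 1 ≤ b) → weight h (b ∸ 1) ≤ N b
  fresh-weight≤ h b positive with defined? h
  fresh-weight≤ h zero    positive | yes def with positive def
  ... | ()
  fresh-weight≤ h (suc b) positive | yes _ = ≤-refl
  fresh-weight≤ h b       positive | no _  = z≤n

  rhs-weight< : ∀ {l r} → (l , r) ∈ S → ∀ b → size r * N b < K ^ b
  rhs-weight< {r = r} l→r zero    = subst (_< 1) (sym (*-zeroʳ (size r))) (s≤s z≤n)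
  rhs-weight< {r = r} l→r (suc b) = *-monoˡ-< (K ^ b) {{m^n≢0 K b {{K≢0}}}}
    (≤-trans (s≤s (rhs-size≤total S l→r)) (n<2^n (rhsTotalSize S)))
    where
    n<2^n : ∀ n → n < 2 ^ n
    n<2^n zero    = s≤s z≤n
    n<2^n (suc n) = +-mono-≤ {1} (≤-trans (s≤s z≤n) (n<2^n n)) (≤-trans (n<2^n n) (m≤m+n (2 ^ n) 0))

  -- DP-heights are preserved by S-steps below the root (they are absorbed by
  -- the  →S*  prefix of relative steps) ...
  dp-height-below : ∀ {f s₀ s₀' b} → s₀ →S s₀' → DPHeight≤ (app f s₀) b → DPHeight≤ (app f s₀') b
  dp-height-below st height zero a chain = z≤n
  dp-height-below {f} st height (suc k) a (next (a₁ , b₁ , pre , dp , post) chain) =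
    height (suc k) a (next (a₁ , b₁ , cong (inj₂ f) (emb-step st) ◅ pre , dp , post) chain)

  -- ... and drop by one along a dependency pair  l♯ → v♯  instantiated by σ.
  dp-height-pair : ∀ {l r v σ b} → (l , r) ∈ S → Subterm v r →
    (∃ λ h → rootSym v ≡ just h × Defined S h) → ¬ ProperSubterm v l →
    DPHeight≤ (l ⟨ σ ⟩) b → 1 ≤ b × DPHeight≤ (v ⟨ σ ⟩) (b ∸ 1)
  dp-height-pair {l} {r} {v} {σ} {b} l→r v⊴r (h , v-root , def) v⋪l height =
    height 1 _ (extend done) , λ k a chain → ≤-pred′ (height (suc k) a (extend chain))
    where
    pair : Step (DP S) (sharp (l ⟨ σ ⟩)) (sharp (v ⟨ σ ⟩))
    pair = subst₂ (Step (DP S)) (sym (sharp-subst l σ (lhs-root l→r))) (sym (sharp-subst v σ (h , v-root)))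
             (root (emb ∘ σ) (l , r , v , l→r , v⊴r , (h , v-root , def) , v⋪l , refl , refl))
    extend : ∀ {k a} → Iter _→DP/S_ k (sharp (v ⟨ σ ⟩)) a → Iter _→DP/S_ (suc k) (sharp (l ⟨ σ ⟩)) a
    extend chain = next (_ , _ , ε , pair , ε) chain
    ≤-pred′ : ∀ {k} → suc k ≤ b → k ≤ b ∸ 1
    ≤-pred′ (s≤s k≤b) = k≤b

  data Annotated : Set where
    avar : ℕ → Annotated
    acon : Fin c → ℕ → Annotated
    aapp : Fin u → ℕ → Annotated → Annotated

  erase : Annotated → T
  erase (avar x)     = var x
  erase (acon a b)   = con a
  erase (aapp f b t) = app f (erase t)

  Φ : Annotated → ℕ
  Φ (avar x)     = 0
  Φ (acon a b)   = weight (inj₁ a) b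
  Φ (aapp f b t) = weight (inj₂ f) b + Φ t

  Sound : Annotated → Set
  Sound (avar x)     = ⊤
  Sound (acon a b)   = Defined S (inj₁ a) → DPHeight≤ (con a) b
  Sound (aapp f b t) = (Defined S (inj₂ f) → DPHeight≤ (app f (erase t)) b) × Sound t

  SoundAnnotation : T → ℕ → Set
  SoundAnnotation t P = ∃ λ a → erase a ≡ t × Sound a × Φ a ≤ P

  sound-subterm : ∀ {v w : T} {σ} → Subterm v w → ∀ a → erase a ≡ w ⟨ σ ⟩ → Sound a →
                  SoundAnnotation (v ⟨ σ ⟩) (Φ a)
  sound-subterm here a eq sound = a , eq , sound , ≤-refl
  sound-subterm (there g p) (aapp f b a₀) eq (_ , sound₀) with sound-subterm p a₀ (app-injectiveʳ eq) sound₀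
  ... | a' , eq' , sound' , Φ≤ = a' , eq' , sound' , ≤-trans Φ≤ (m≤n+m (Φ a₀) (weight (inj₂ f) b))

  -- Annotating the contractum of a redex  lσ  with budget b: the parts of r
  -- inherited from l keep their annotation (of potential ≤ P₀), the new symbols
  -- get budget  b ∸ 1,  which is sound by  dp-height-pair.
  annotate-contractum : ∀ {l r σ} b P₀ → (l , r) ∈ S → DPHeight≤ (l ⟨ σ ⟩) b →
    (∀ v → ProperSubterm v l → SoundAnnotation (v ⟨ σ ⟩) P₀) →
    ∀ r' → Subterm r' r → SoundAnnotation (r' ⟨ σ ⟩) (size r' * N b + P₀)
  annotate-contractum {l} b P₀ l→r height inherited r' r'⊴r with proper? r' l
  ... | yes r'◁l with inherited r' r'◁l
  ... | a , eq , sound , Φ≤ = a , eq , sound , ≤-trans Φ≤ (m≤n+m P₀ (size r' * N b))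
  annotate-contractum b P₀ l→r height inherited (var y) y⊴r | no y⋪l =
    ⊥-elim (y⋪l (rhs-var-below-lhs l→r y⊴r))
  annotate-contractum b P₀ l→r height inherited (con a) a⊴r | no a⋪l =
    acon a (b ∸ 1) , refl , (λ def → proj₂ (new def)) ,
    ≤-trans (fresh-weight≤ (inj₁ a) b (proj₁ ∘ new)) (≤-trans (m≤m+n (N b) 0) (m≤m+n (N b + 0) P₀))
    where
    new : Defined S (inj₁ a) → 1 ≤ b × DPHeight≤ (con a) (b ∸ 1)
    new def = dp-height-pair l→r a⊴r (inj₁ a , refl , def) a⋪l height
  annotate-contractum {σ = σ} b P₀ l→r height inherited (app g r₀) gr₀⊴r | no gr₀⋪l
    with annotate-contractum b P₀ l→r height inherited r₀ (subterm-trans (there g here) gr₀⊴r)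
  ... | a₀ , eq , sound₀ , Φ≤ =
    aapp g (b ∸ 1) a₀ , ≡-cong (app g) eq ,
    ((λ def → subst (λ x → DPHeight≤ (app g x) (b ∸ 1)) (sym eq) (proj₂ (new def))) , sound₀) ,
    ≤-trans (+-mono-≤ (fresh-weight≤ (inj₂ g) b (proj₁ ∘ new)) Φ≤)
            (≤-reflexive (sym (+-assoc (N b) (size r₀ * N b) P₀)))
    where
    new : Defined S (inj₂ g) → 1 ≤ b × DPHeight≤ (app g r₀ ⟨ σ ⟩) (b ∸ 1)
    new def = dp-height-pair l→r gr₀⊴r (inj₂ g , refl , def) gr₀⋪l height

  -- A rewrite step at the root replaces a defined symbol of weight K^b by a
  -- contractum of potential  < K^b  on top of the inherited subterm.
  root-step-decreases : ∀ a {l r σ} → Sound a → (l , r) ∈ S → erase a ≡ l ⟨ σ ⟩ →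
                        ∃ λ a' → erase a' ≡ r ⟨ σ ⟩ × Sound a' × Φ a' < Φ a
  root-step-decreases a {var x} _ l→r _ = ⊥-elim (lhs-not-var l→r x refl)
  root-step-decreases (acon a b) {con .a} {r} {σ} sound l→r refl
    with annotate-contractum b 0 l→r (sound (con a , r , l→r , refl)) (λ _ ()) r here
  ... | a' , eq , sound' , Φ≤ = a' , eq , sound' , (begin-strict
    Φ a'               ≤⟨ Φ≤ ⟩
    size r * N b + 0   <⟨ +-monoˡ-< 0 (rhs-weight< l→r b) ⟩
    K ^ b + 0          ≡⟨ +-identityʳ (K ^ b) ⟩
    K ^ b              ≡⟨ weight-defined (inj₁ a) b (con a , r , l→r , refl) ⟨
    weight (inj₁ a) b  ∎)
    where open ≤-Reasoning
  root-step-decreases (aapp f b a₀) {app g l₀} {r} {σ} (sound-top , sound₀) l→r eq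
    with app-injectiveˡ eq
  ... | refl with annotate-contractum b (Φ a₀) l→r height inherited r here
    where
    height : DPHeight≤ (app f l₀ ⟨ σ ⟩) b
    height = subst (λ x → DPHeight≤ (app f x) b) (app-injectiveʳ eq) (sound-top (app f l₀ , r , l→r , refl))
    inherited : ∀ v → ProperSubterm v (app f l₀) → SoundAnnotation (v ⟨ σ ⟩) (Φ a₀)
    inherited v (psub _ v⊴l₀) = sound-subterm v⊴l₀ a₀ (app-injectiveʳ eq) sound₀
  ... | a' , eq' , sound' , Φ≤ = a' , eq' , sound' , (begin-strict
    Φ a'                       ≤⟨ Φ≤ ⟩
    size r * N b + Φ a₀        <⟨ +-monoˡ-< (Φ a₀) (rhs-weight< l→r b) ⟩
    K ^ b + Φ a₀               ≡⟨ ≡-cong (_+ Φ a₀) (weight-defined (inj₂ f) b (app f l₀ , r , l→r , refl)) ⟨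
    weight (inj₂ f) b + Φ a₀   ∎)
    where open ≤-Reasoning
  root-step-decreases (avar x)     {con _}   _ _ ()
  root-step-decreases (avar x)     {app _ _} _ _ ()
  root-step-decreases (acon a b)   {app _ _} _ _ ()
  root-step-decreases (aapp f b t) {con _}   _ _ ()

  step-decreases : ∀ a {t} → Sound a → erase a →S t → ∃ λ a' → erase a' ≡ t × Sound a' × Φ a' < Φ a
  step-decreases a sound st with step-view st
  ... | at-root l r σ l→r a≡lσ refl = root-step-decreases a sound l→r a≡lσ
  step-decreases (aapp f b a₀) (sound-top , sound₀) st | below _ _ _ refl refl st₀
    with step-decreases a₀ sound₀ st₀
  ... | a₀' , refl , sound₀' , Φ< =
    aapp f b a₀' , refl , ((λ def → dp-height-below st₀ (sound-top def)) , sound₀') ,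
    +-monoʳ-< (weight (inj₂ f) b) Φ<

  derivation≤potential : ∀ k a {t} → Sound a → Iter _→S_ k (erase a) t → k ≤ Φ a
  derivation≤potential zero    a sound done         = z≤n
  derivation≤potential (suc k) a sound (next st d) with step-decreases a sound st
  ... | a' , refl , sound' , Φ< = ≤-trans (s≤s (derivation≤potential k a' sound' d)) Φ<

  annotate : ℕ → T → Annotated
  annotate b (var x)   = avar x
  annotate b (con a)   = acon a b
  annotate b (app f t) = aapp f b (annotate b t)

  erase-annotate : ∀ b t → erase (annotate b t) ≡ t
  erase-annotate b (var x)   = refl
  erase-annotate b (con a)   = refl
  erase-annotate b (app f t) = ≡-cong (app f) (erase-annotate b t)

  annotate-sound : ∀ b t → (∀ t' → Subterm t' t → DPHeight≤ t' b) → Sound (annotate b t)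
  annotate-sound b (var x)   height = tt
  annotate-sound b (con a)   height = λ _ → height (con a) here
  annotate-sound b (app f t) height =
    (λ _ → subst (λ x → DPHeight≤ (app f x) b) (sym (erase-annotate b t)) (height _ here)) ,
    annotate-sound b t (λ t' t'⊴t → height t' (there f t'⊴t))

  annotate-potential : ∀ b t → Φ (annotate b t) ≤ size t * K ^ b
  annotate-potential b (var x)   = z≤n
  annotate-potential b (con a)   = ≤-trans (weight≤ (inj₁ a) b) (m≤m+n (K ^ b) 0)
  annotate-potential b (app f t) = +-mono-≤ (weight≤ (inj₂ f) b) (annotate-potential b t)

  derivation≤size*K^F : ∀ n F t {k t'} → size t ≤ n → IsF S n F → Iter _→S_ k t t' → k ≤ size t * K ^ F
  derivation≤size*K^F n F t {k} |t|≤n isF d = begin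
    k                 ≤⟨ derivation≤potential k (annotate F t) sound d′ ⟩
    Φ (annotate F t)  ≤⟨ annotate-potential F t ⟩
    size t * K ^ F    ∎
    where
    open ≤-Reasoning
    d′ : Iter _→S_ k (erase (annotate F t)) _
    d′ = subst (λ x → Iter _→S_ k x _) (sym (erase-annotate F t)) d
    sound : Sound (annotate F t)
    sound = annotate-sound F t (λ t' t'⊴t → dp-height≤f n F t' (≤-trans (size-subterm t'⊴t) |t|≤n) isF)

theorem6p2 : ∀ {c u} (S : TRS c u) → Terminating S →
    ∃ λ (d : ℕ) → ∀ (n F D : ℕ) → IsF S n F → IsDc S n D →
      D ≤ n * 2 ^ (d * (F + 1))
theorem6p2 S terminating = rhsTotalSize S , bound
  where
  open Analysis S terminating
  bound : ∀ n F D → IsF S n F → IsDc S n D → D ≤ n * 2 ^ (rhsTotalSize S * (F + 1))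
  bound n F D isF ((t , |t|≤n , (t' , d) , _) , _) = begin
    D                                ≤⟨ derivation≤size*K^F n F t |t|≤n isF d ⟩
    size t * K ^ F                   ≤⟨ *-monoˡ-≤ (K ^ F) |t|≤n ⟩
    n * K ^ F                        ≤⟨ *-monoʳ-≤ n (^-monoʳ-≤ K {{K≢0}} (m≤m+n F 1)) ⟩
    n * K ^ (F + 1)                  ≡⟨ ≡-cong (n *_) (^-*-assoc 2 (rhsTotalSize S) (F + 1)) ⟩
    n * 2 ^ (rhsTotalSize S * (F + 1)) ∎
    where open ≤-Reasoning
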